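{- Consider any execution of the Low Cost Work Stealing algorithm. Let $v_{1},\ldots,v_{k}$ denote the nodes stored in some processor $p$'s SpDeque (in both its private and public parts), ordered from the bottom of the SpDeque to the top, at some moment during the execution, and let $v_{0}$ denote $p$'s assigned node (if any). Then $w\left(v_{0}\right) \leq w\left(v_{1}\right) < \ldots < w\left(v_{k-1}\right) < w\left(v_{k}\right)$.
   Context: Computation model. A computation is a directed acyclic graph $G=(V,E)$ with exactly one root and one sink, every node having out-degree at most $2$; $T_\infty$ is the length of a longest directed path. A node is ready when all its ancestors have been executed. If executing a node $u$ makes a node $u'$ ready, $(u,u')$ is an enabling edge and $u$ is the designated parent of $u'$; the enabling edges of an execution form the enabling tree, $d(u)$ denotes the depth of $u$ in it, and the weight of $u$ is $w(u)=T_\infty-d(u)$. Split deque (SpDeque). Each processor owns an SpDeque: a deque of ready nodes split into a public part (top portion) and a private part (bottom portion), the private part accessible only to the owner. Methods: push (push a node onto the bottom of the private part); pop (remove and return the bottom node of the private part, or RACE if empty); updateBottom (move the topmost node of the private part to the bottom of the public part; no effect if the private part is empty); popBottom (remove and return the bottom node of the public part, or EMPTY); popTop (attempt to remove and return the top node of the public part; returns EMPTY if the public part is empty, or ABORT with no effect). It is assumed that every set of invocations issued by the algorithm meets the relaxed semantics: there are pairwise distinct linearization times for non-aborting invocations, each within its invocation's interval, with return values consistent with a serial execution in that order, and each aborted popTop on a deque $d$ overlaps the linearization time of another invocation removing the topmost item of $d$. Low Cost Work Stealing. Each processor has an SpDeque, an assigned node (initially none) and a Boolean flag targeted (initially false);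 one processor is initially assigned the root. Each processor repeats until termination: (1) if targeted is true, invoke updateBottom on its own SpDeque and set targeted to false; (2) if it has an assigned node, execute it; if at least one node is enabled, one of them becomes the new assigned node and, if two, the other is pushed onto its SpDeque; if none, the new assigned node is the result of pop, and if that is RACE, of popBottom; (3) otherwise choose a victim processor uniformly at random, set the assigned node to the result of popTop on the victim's SpDeque, and if it is EMPTY set the victim's targeted flag to true. -}

module Defs where

open import Data.Nat using (ℕ; zero; suc; _+_; _≤_)
open import Data.Integer as ℤ using (ℤ; +_)
open import Data.Fin using (Fin; _≟_)
open import Data.List using (List; []; _∷_; _++_; [_]; length)
open import Data.List.Membership.Propositional using (_∈_)
open import Data.List.Relation.Unary.Unique.Propositional using (Unique)
open import Data.List.Relation.Unary.Linked using (Linked)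
open import Data.Maybe using (Maybe; just; nothing)
open import Data.Bool using (Bool; true; false; if_then_else_)
open import Data.Product using (_×_; ∃; ∃-syntax; Σ; _,_)
open import Relation.Nullary using (¬_)
open import Relation.Nullary.Decidable using (⌊_⌋)
open import Relation.Binary.PropositionalEquality using (_≡_)
open import Relation.Binary.Construct.Closure.ReflexiveTransitive using (Star)

-- A finite directed multigraph on nodes Fin n, given by successor lists
-- (one list entry per outgoing edge).
record Graph : Set where
  field
    n    : ℕ
    succ : Fin n → List (Fin n)

open Graph public

Node : Graph → Set
Node G = Fin (n G)

Edge : (G : Graph) → Node G → Node G → Set
Edge G u v = v ∈ succ G u

data Path (G : Graph) : Node G → Node G → ℕ → Set where
  here : ∀ {u} → Path G u u 0
  step : ∀ {u w v ℓ} → Edge G u w → Path G w v ℓ → Path G u v (suc ℓ)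

Ancestor : (G : Graph) → Node G → Node G → Set
Ancestor G a u = ∃[ ℓ ] Path G a u (suc ℓ)

record IsComputation (G : Graph) : Set where
  field
    outdeg      : ∀ u → length (succ G u) ≤ 2
    acyclic     : ∀ u ℓ → ¬ Path G u u (suc ℓ)
    root        : Node G
    root-noIn   : ∀ u → ¬ Edge G u root
    root-unique : ∀ v → (∀ u → ¬ Edge G u v) → v ≡ root
    sink        : Node G
    sink-noOut  : succ G sink ≡ []
    sink-unique : ∀ v → succ G v ≡ [] → v ≡ sink

open IsComputation public

IsSpan : (G : Graph) → ℕ → Set
IsSpan G T = (∃[ u ] ∃[ v ] Path G u v T) × (∀ u v ℓ → Path G u v ℓ → ℓ ≤ T)

-- Low Cost Work Stealing, as an interleaving transition system in which
-- every SpDeque invocation takes effect atomically at its linearization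
-- point.

upd : ∀ {m} {A : Set} → (Fin m → A) → Fin m → (A → A) → Fin m → A
upd f i g x = if ⌊ x ≟ i ⌋ then g (f x) else f x

module LCWS (G : Graph) (P : ℕ) where

  -- where a processor is inside its main loop
  data Phase : Set where
    start          : Phase            -- about to perform line (1)
    clearTarget    : Phase            -- updateBottom done, about to reset targeted
    main           : Phase            -- about to perform line (2) or (3)
    pushPending    : Node G → Phase   -- new assigned node set, must push the other
    popPhase       : Phase            -- no enabled node: about to invoke pop
    popBottomPhase : Phase            -- pop returned RACE: about to invoke popBottom
    setTarget      : Fin P → Phase    -- popTop returned EMPTY: about to set victim's flag

  -- A processor. Its SpDeque, listed from bottom to top, is  priv ++ pub :
  -- priv is the private (bottom) part, pub the public (top) part,
  -- each listed from its bottom to its top.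
  record Proc : Set where
    field
      priv     : List (Node G)
      pub      : List (Node G)
      assigned : Maybe (Node G)
      targeted : Bool
      phase    : Phase

  open Proc public

  record State : Set where
    field
      executed : Node G → Bool
      depth    : Node G → ℕ      -- depth in the enabling tree (of ready/enabled nodes)
      procs    : Fin P → Proc

  open State public

  modify : State → Fin P → (Proc → Proc) → State
  modify s i g = record s { procs = upd (procs s) i g }

  Ready : (Node G → Bool) → Node G → Set
  Ready E u = ∀ a → Ancestor G a u → E a ≡ true

  markExec : (Node G → Bool) → Node G → Node G → Bool
  markExec E u = upd E u (λ _ → true)

  Enables : State → Node G → Node G → Set
  Enables s u v = ¬ Ready (executed s) v × Ready (markExec (executed s) u) v

  EnabledList : State → Node G → List (Node G) → Set
  EnabledList s u L = Unique L × (∀ v → (v ∈ L → Enables s u v) × (Enables s u v → v ∈ L))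

  -- the designated parent of each enabled node is u: depth = depth u + 1
  setDepths : List (Node G) → ℕ → (Node G → ℕ) → Node G → ℕ
  setDepths []      k d = d
  setDepths (v ∷ L) k d = upd (setDepths L k d) v (λ _ → k)

  execState : State → Node G → List (Node G) → State
  execState s u L = record s
    { executed = markExec (executed s) u
    ; depth    = setDepths L (suc (depth s u)) (depth s) }

  data Step (i : Fin P) (s : State) : State → Set where
    -- line (1)
    tgt-move  : ∀ {init x} → phase (procs s i) ≡ start → targeted (procs s i) ≡ true →
                priv (procs s i) ≡ init ++ [ x ] →
                Step i s (modify s i (λ q → record q { priv = init ; pub = x ∷ pub q ; phase = clearTarget }))
    tgt-empty : phase (procs s i) ≡ start → targeted (procs s i) ≡ true →
                priv (procs s i) ≡ [] →
                Step i s (modify s i (λ q → record q { phase = clearTarget }))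
    clear     : phase (procs s i) ≡ clearTarget →
                Step i s (modify s i (λ q → record q { targeted = false ; phase = main }))
    no-tgt    : phase (procs s i) ≡ start → targeted (procs s i) ≡ false →
                Step i s (modify s i (λ q → record q { phase = main }))
    -- line (2)
    exec0     : ∀ {u} → phase (procs s i) ≡ main → assigned (procs s i) ≡ just u →
                EnabledList s u [] →
                Step i s (modify (execState s u []) i (λ q → record q { assigned = nothing ; phase = popPhase }))
    exec1     : ∀ {u a} → phase (procs s i) ≡ main → assigned (procs s i) ≡ just u →
                EnabledList s u (a ∷ []) →
                Step i s (modify (execState s u (a ∷ [])) i (λ q → record q { assigned = just a ; phase = start }))
    exec2     : ∀ {u a b} → phase (procs s i) ≡ main → assigned (procs s i) ≡ just u →
                EnabledList s u (a ∷ b ∷ []) →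
                Step i s (modify (execState s u (a ∷ b ∷ [])) i (λ q → record q { assigned = just a ; phase = pushPending b }))
    push      : ∀ {b} → phase (procs s i) ≡ pushPending b →
                Step i s (modify s i (λ q → record q { priv = b ∷ priv q ; phase = start }))
    pop-ok    : ∀ {x rest} → phase (procs s i) ≡ popPhase → priv (procs s i) ≡ x ∷ rest →
                Step i s (modify s i (λ q → record q { priv = rest ; assigned = just x ; phase = start }))
    pop-race  : phase (procs s i) ≡ popPhase → priv (procs s i) ≡ [] →
                Step i s (modify s i (λ q → record q { phase = popBottomPhase }))
    popB-ok   : ∀ {x rest} → phase (procs s i) ≡ popBottomPhase → pub (procs s i) ≡ x ∷ rest →
                Step i s (modify s i (λ q → record q { pub = rest ; assigned = just x ; phase = start }))
    popB-empty : phase (procs s i) ≡ popBottomPhase → pub (procs s i) ≡ [] →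
                Step i s (modify s i (λ q → record q { assigned = nothing ; phase = start }))
    -- line (3): popTop on victim j
    steal-ok  : ∀ {init x} (j : Fin P) → phase (procs s i) ≡ main → assigned (procs s i) ≡ nothing →
                pub (procs s j) ≡ init ++ [ x ] →
                Step i s (modify (modify s j (λ q → record q { pub = init })) i
                                 (λ q → record q { assigned = just x ; phase = start }))
    steal-empty : (j : Fin P) → phase (procs s i) ≡ main → assigned (procs s i) ≡ nothing →
                pub (procs s j) ≡ [] →
                Step i s (modify s i (λ q → record q { phase = setTarget j }))
    steal-abort : (j : Fin P) → phase (procs s i) ≡ main → assigned (procs s i) ≡ nothing →
                Step i s (modify s i (λ q → record q { phase = start }))
    set-tgt   : ∀ {j} → phase (procs s i) ≡ setTarget j →
                Step i s (modify (modify s j (λ q → record q { targeted = true })) i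
                                 (λ q → record q { phase = start }))

  AnyStep : State → State → Set
  AnyStep s s' = ∃[ i ] Step i s s'

  initial : Node G → Fin P → State
  initial r p0 = record
    { executed = λ _ → false
    ; depth    = λ _ → 0
    ; procs    = λ i → record { priv = [] ; pub = [] ; targeted = false ; phase = start
                              ; assigned = if ⌊ i ≟ p0 ⌋ then just r else nothing } }

  Reachable : Node G → Fin P → State → Set
  Reachable r p0 s = Star AnyStep (initial r p0) s

  -- weight w(u) = T∞ − d(u)   (as an integer, no truncation)
  weight : ℕ → State → Node G → ℤ
  weight T s u = + T ℤ.- + depth s u

  -- the conclusion of the corollary for processor p in state s:
  -- v₁,…,v_k = priv ++ pub (bottom to top), v₀ = assigned node (if any);
  -- w(v₀) ≤ w(v₁) < … < w(v_k).
  WeightOrdered : ℕ → State → Fin P → Set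
  WeightOrdered T s p =
    (∀ v₀ v₁ rest → assigned (procs s p) ≡ just v₀ → priv (procs s p) ++ pub (procs s p) ≡ v₁ ∷ rest →
       weight T s v₀ ℤ.≤ weight T s v₁)
    × Linked (λ a b → weight T s a ℤ.< weight T s b) (priv (procs s p) ++ pub (procs s p))

module Submission where

-- Since w(u) = T∞ − d(u), the corollary is a statement about enabling-tree
-- depths, and we prove it as an invariant of the transition system.  A
-- processor *holds* the node it is about to push (after executing a node
-- with two children) followed by its SpDeque, bottom to top.  The invariant
-- `Sound` says: the held and assigned nodes are ready; depths strictly
-- decrease along the held list; the assigned node is at least as deep as the
-- bottom held node; popBottom runs only with an empty private part; and an
-- unassigned processor outside pop/popBottom holds nothing.  Readiness makes
-- the invariant survive executions by other processors, since executing a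
-- node only assigns depths to nodes that were not ready before.

open import Defs
open import Data.Nat using (ℕ; suc; _≤_; _<_)
import Data.Nat.Properties as ℕ
open import Data.Integer as ℤ using (+_)
import Data.Integer.Properties as ℤ
open import Data.Fin using (Fin; _≟_)
open import Data.List using (List; []; _∷_; _++_; [_])
open import Data.List.Properties using (++-assoc; ++-conicalʳ)
open import Data.List.Membership.Propositional using (_∈_)
open import Data.List.Relation.Unary.Any using (here; there)
open import Data.List.Relation.Unary.All as All using (All; []; _∷_)
open import Data.List.Relation.Unary.All.Properties using (++⁻ˡ; ++⁻ʳ)
open import Data.List.Relation.Unary.Linked as Linked using (Linked; []; [-]; _∷_)
open import Data.Maybe using (Maybe; just; nothing)
import Data.Maybe.Relation.Unary.All as Maybe
open import Data.Bool using (Bool; true; false; if_then_else_)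
open import Data.Product using (_×_; ∃-syntax; _,_; proj₁; proj₂)
open import Data.Unit using (⊤; tt)
open import Data.Empty using (⊥-elim)
open import Relation.Nullary using (¬_; yes; no)
open import Relation.Nullary.Decidable using (⌊_⌋)
open import Relation.Binary.PropositionalEquality
  using (_≡_; refl; sym; trans; cong; cong₂; subst; subst₂; module ≡-Reasoning)
open ≡-Reasoning
open import Relation.Binary.Construct.Closure.ReflexiveTransitive using (Star; ε; _◅_)

module _ {A : Set} where

  Decreasing : (A → ℕ) → List A → Set
  Decreasing d = Linked (λ x y → d y < d x)

  HeadAtMost : (A → ℕ) → ℕ → List A → Set
  HeadAtMost d k []      = ⊤
  HeadAtMost d k (v ∷ _) = d v ≤ k

  module _ {d : A → ℕ} where

    headAtMost-weaken : ∀ {k k′} xs → k ≤ k′ → HeadAtMost d k xs → HeadAtMost d k′ xs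
    headAtMost-weaken []      _    _   = tt
    headAtMost-weaken (_ ∷ _) k≤k′ v≤k = ℕ.≤-trans v≤k k≤k′

    headAtMost-prefix : ∀ {k} xs {ys} → HeadAtMost d k (xs ++ ys) → HeadAtMost d k xs
    headAtMost-prefix []      _   = tt
    headAtMost-prefix (_ ∷ _) v≤k = v≤k

    decreasing-head : ∀ {x} xs → Decreasing d (x ∷ xs) → HeadAtMost d (d x) xs
    decreasing-head []      _       = tt
    decreasing-head (_ ∷ _) (y<x ∷ _) = ℕ.<⇒≤ y<x

    decreasing-cons : ∀ {x k} xs → k < d x → HeadAtMost d k xs → Decreasing d xs →
                      Decreasing d (x ∷ xs)
    decreasing-cons []      _   _   _  = [-]
    decreasing-cons (_ ∷ _) k<x v≤k ds = ℕ.≤-<-trans v≤k k<x ∷ ds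

    headAtMost-suffix : ∀ {k} p {xs} → Decreasing d (p ++ xs) → HeadAtMost d k (p ++ xs) →
                        HeadAtMost d k xs
    headAtMost-suffix []          _  h = h
    headAtMost-suffix (y ∷ p) {xs} ds h =
      headAtMost-suffix p (Linked.tail ds) (headAtMost-weaken (p ++ xs) h (decreasing-head (p ++ xs) ds))

    headAtMost-head : ∀ {k xs v r} → xs ≡ v ∷ r → HeadAtMost d k xs → d v ≤ k
    headAtMost-head refl v≤k = v≤k

    module _ {d′ : A → ℕ} where

      decreasing-agree : ∀ {xs} → All (λ v → d′ v ≡ d v) xs → Decreasing d xs → Decreasing d′ xs
      decreasing-agree _                    []          = []
      decreasing-agree _                    [-]         = [-]
      decreasing-agree (ex ∷ ey ∷ es) (y<x ∷ ds) =
        subst₂ _<_ (sym ey) (sym ex) y<x ∷ decreasing-agree (ey ∷ es) ds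

      headAtMost-agree : ∀ {k xs} → All (λ v → d′ v ≡ d v) xs → HeadAtMost d k xs → HeadAtMost d′ k xs
      headAtMost-agree []         _   = tt
      headAtMost-agree (ev ∷ _) v≤k = subst (_≤ _) (sym ev) v≤k

  linked-prefix : ∀ {R : A → A → Set} xs {ys} → Linked R (xs ++ ys) → Linked R xs
  linked-prefix []               _        = []
  linked-prefix (_ ∷ [])         _        = [-]
  linked-prefix (_ ∷ y ∷ xs) (r ∷ l) = r ∷ linked-prefix (y ∷ xs) l

  snoc-nonempty : ∀ xs (x : A) → ¬ xs ++ [ x ] ≡ []
  snoc-nonempty xs x e with ++-conicalʳ xs [ x ] e
  ... | ()

  linked-suffix : ∀ {R : A → A → Set} p {xs} → Linked R (p ++ xs) → Linked R xs
  linked-suffix []      l = l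
  linked-suffix (_ ∷ p) l = linked-suffix p (Linked.tail l)

module _ {m : ℕ} {A : Set} (f : Fin m → A) (i : Fin m) (g : A → A) where

  upd-other : ∀ k → ¬ k ≡ i → upd f i g k ≡ f k
  upd-other k k≢i with k ≟ i
  ... | yes k≡i = ⊥-elim (k≢i k≡i)
  ... | no _    = refl

  upd-all : (Q : A → Set) → (∀ k → Q (f k)) → Q (g (f i)) → ∀ k → Q (upd f i g k)
  upd-all Q all-f at-i k with k ≟ i
  ... | yes refl = at-i
  ... | no _     = all-f k

  upd-attribute : {B : Set} (π : A → B) → (∀ q → π (g q) ≡ π q) → ∀ k → π (upd f i g k) ≡ π (f k)
  upd-attribute π keeps k with k ≟ i
  ... | yes refl = keeps (f k)
  ... | no _     = refl

last-edge : ∀ {G a v ℓ} → Path G a v (suc ℓ) → ∃[ u ] Edge G u v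
last-edge (step e here)          = _ , e
last-edge (step _ (step e path)) = last-edge (step e path)

module Invariant (G : Graph) (P : ℕ) where
  open LCWS G P

  private
    N : Set
    N = Node G

  pending : Phase → List N
  pending (pushPending b) = [ b ]
  pending _               = []

  held : Phase → List N → List N → List N
  held ph pv pb = pending ph ++ pv ++ pb

  data Settled : Phase → Set where
    st-start  : Settled start
    st-clear  : Settled clearTarget
    st-main   : Settled main
    st-push   : ∀ b → Settled (pushPending b)
    st-target : ∀ j → Settled (setTarget j)

  settledAt : ∀ {ph ph₀} → ph ≡ ph₀ → Settled ph₀ → Settled ph
  settledAt refl s = s

  -- Settled phases exclude popBottom, so reshaped processors satisfy bottom-public.
  settled-not-popBottom : ∀ {ph} → Settled ph → ¬ ph ≡ popBottomPhase
  settled-not-popBottom (st-push _)   ()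
  settled-not-popBottom (st-target _) ()

  record Sound (E : N → Bool) (d : N → ℕ) (pv pb : List N) (a : Maybe N) (ph : Phase) : Set where
    field
      ready-assigned   : Maybe.All (Ready E) a
      ready-held       : All (Ready E) (held ph pv pb)
      decreasing       : Decreasing d (held ph pv pb)
      assigned-deepest : Maybe.All (λ u → HeadAtMost d (d u) (held ph pv pb)) a
      bottom-public    : ph ≡ popBottomPhase → pv ≡ []
      idle             : a ≡ nothing → Settled ph → held ph pv pb ≡ []

  open Sound

  module _ {E : N → Bool} {d : N → ℕ} where

    -- Steps that only move nodes between the pending slot, the private and
    -- the public part (updateBottom, push) or only change a settled phase.
    reshape : ∀ {pv pb a ph pv′ pb′ ph′} → Settled ph → Settled ph′ →
              held ph pv pb ≡ held ph′ pv′ pb′ → Sound E d pv pb a ph → Sound E d pv′ pb′ a ph′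
    reshape s s′ eq S = record
      { ready-assigned   = ready-assigned S
      ; ready-held       = subst (All _) eq (ready-held S)
      ; decreasing       = subst (Decreasing d) eq (decreasing S)
      ; assigned-deepest = Maybe.map (subst (HeadAtMost d _) eq) (assigned-deepest S)
      ; bottom-public    = λ e → ⊥-elim (settled-not-popBottom s′ e)
      ; idle             = λ a≡nothing _ → trans (sym eq) (idle S a≡nothing s) }

    rephase : ∀ {pv pb a ph ph₀ ph′} → ph ≡ ph₀ → Settled ph₀ → Settled ph′ →
              pending ph₀ ≡ pending ph′ → Sound E d pv pb a ph → Sound E d pv pb a ph′
    rephase refl s s′ eq = reshape s s′ (cong (_++ _) eq)

    exec-leaf : ∀ {pv pb a ph} → ph ≡ main → Sound E d pv pb a ph → Sound E d pv pb nothing popPhase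
    exec-leaf refl S = record
      { ready-assigned   = Maybe.nothing
      ; ready-held       = ready-held S
      ; decreasing       = decreasing S
      ; assigned-deepest = Maybe.nothing
      ; bottom-public    = λ ()
      ; idle             = λ _ () }

    exec-one : ∀ {pv pb ph u c} → ph ≡ main → Ready E c → d c ≡ suc (d u) →
               Sound E d pv pb (just u) ph → Sound E d pv pb (just c) start
    exec-one {pv} {pb} {u = u} {c} refl rc dc S = record
      { ready-assigned   = Maybe.just rc
      ; ready-held       = ready-held S
      ; decreasing       = decreasing S
      ; assigned-deepest = Maybe.just (headAtMost-weaken (pv ++ pb) u≤c (Maybe.drop-just (assigned-deepest S)))
      ; bottom-public    = λ ()
      ; idle             = λ () }
      where
        u≤c : d u ≤ d c
        u≤c = subst (d u ≤_) (sym dc) (ℕ.n≤1+n (d u))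

    exec-two : ∀ {pv pb ph u c c′} → ph ≡ main → Ready E c → d c ≡ suc (d u) →
               Ready E c′ → d c′ ≡ suc (d u) →
               Sound E d pv pb (just u) ph → Sound E d pv pb (just c) (pushPending c′)
    exec-two {pv} {pb} {u = u} refl rc dc rc′ dc′ S = record
      { ready-assigned   = Maybe.just rc
      ; ready-held       = rc′ ∷ ready-held S
      ; decreasing       = decreasing-cons (pv ++ pb) (subst (d u <_) (sym dc′) (ℕ.n<1+n (d u)))
                             (Maybe.drop-just (assigned-deepest S)) (decreasing S)
      ; assigned-deepest = Maybe.just (ℕ.≤-reflexive (trans dc′ (sym dc)))
      ; bottom-public    = λ ()
      ; idle             = λ () }

    adopt : ∀ {pv pb a ph x pv′ pb′} → held ph pv pb ≡ x ∷ held start pv′ pb′ →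
            Sound E d pv pb a ph → Sound E d pv′ pb′ (just x) start
    adopt {x = x} {pv′} {pb′} eq S = record
      { ready-assigned   = Maybe.just (All.head held′)
      ; ready-held       = All.tail held′
      ; decreasing       = Linked.tail decreasing′
      ; assigned-deepest = Maybe.just (decreasing-head (pv′ ++ pb′) decreasing′)
      ; bottom-public    = λ ()
      ; idle             = λ () }
      where
        held′ : All (Ready E) (x ∷ pv′ ++ pb′)
        held′ = subst (All _) eq (ready-held S)
        decreasing′ : Decreasing d (x ∷ pv′ ++ pb′)
        decreasing′ = subst (Decreasing d) eq (decreasing S)

    -- popBottom takes the bottom of the public part, which (the private part
    -- being empty) is the bottom held node.
    popBottom-ok : ∀ {pv pb a ph x rest} → ph ≡ popBottomPhase → pb ≡ x ∷ rest →
                   Sound E d pv pb a ph → Sound E d pv rest (just x) start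
    popBottom-ok refl refl S with bottom-public S refl
    ... | refl = adopt refl S

    race-to-popBottom : ∀ {pv pb a ph} → ph ≡ popPhase → pv ≡ [] → Sound E d pv pb a ph →
                        Sound E d pv pb a popBottomPhase
    race-to-popBottom refl refl S = record
      { ready-assigned   = ready-assigned S
      ; ready-held       = ready-held S
      ; decreasing       = decreasing S
      ; assigned-deepest = assigned-deepest S
      ; bottom-public    = λ _ → refl
      ; idle             = λ _ () }

    popBottom-empty : ∀ {pv pb a ph} → ph ≡ popBottomPhase → pb ≡ [] → Sound E d pv pb a ph →
                      Sound E d pv pb nothing start
    popBottom-empty refl refl S with bottom-public S refl
    ... | refl = record
      { ready-assigned   = Maybe.nothing
      ; ready-held       = []
      ; decreasing       = []
      ; assigned-deepest = Maybe.nothing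
      ; bottom-public    = λ ()
      ; idle             = λ _ _ → refl }

    idle-empty : ∀ {pv pb a ph} → ph ≡ main → a ≡ nothing → Sound E d pv pb a ph → pv ++ pb ≡ []
    idle-empty refl a≡nothing S = idle S a≡nothing st-main

    -- The thief of a successful steal: it held nothing, so any ready node
    -- may become its assigned node.
    steal-thief : ∀ {pv pb a ph x} → ph ≡ main → a ≡ nothing → Ready E x →
                  Sound E d pv pb a ph → Sound E d pv pb (just x) start
    steal-thief {pv} {pb} ph a≡nothing rx S = record
      { ready-assigned   = Maybe.just rx
      ; ready-held       = subst (All _) (sym empty) []
      ; decreasing       = subst (Decreasing d) (sym empty) []
      ; assigned-deepest = Maybe.just (subst (HeadAtMost d _) (sym empty) tt)
      ; bottom-public    = λ ()
      ; idle             = λ () }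
      where
        empty : pv ++ pb ≡ []
        empty = idle-empty ph a≡nothing S

    steal-victim : ∀ {pv pb a ph init x} → pb ≡ init ++ [ x ] → Sound E d pv pb a ph →
                   Sound E d pv init a ph × Ready E x
    steal-victim {pv} {ph = ph} {init} {x} refl S = record
      { ready-assigned   = ready-assigned S
      ; ready-held       = ++⁻ˡ rest (subst (All _) eq (ready-held S))
      ; decreasing       = linked-prefix rest (subst (Decreasing d) eq (decreasing S))
      ; assigned-deepest = Maybe.map (λ h → headAtMost-prefix rest (subst (HeadAtMost d _) eq h))
                             (assigned-deepest S)
      ; bottom-public    = bottom-public S
      ; idle             = λ a≡nothing s → ⊥-elim (snoc-nonempty rest x (trans (sym eq) (idle S a≡nothing s))) }
      , All.head (++⁻ʳ rest (subst (All _) eq (ready-held S)))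
      where
        rest : List N
        rest = held ph pv init
        eq : held ph pv (init ++ [ x ]) ≡ rest ++ [ x ]
        eq = begin
          pending ph ++ pv ++ init ++ [ x ]    ≡⟨ cong (pending ph ++_) (++-assoc pv init [ x ]) ⟨
          pending ph ++ (pv ++ init) ++ [ x ]  ≡⟨ ++-assoc (pending ph) (pv ++ init) [ x ] ⟨
          rest ++ [ x ]                        ∎

    -- Executions by any processor: more nodes get executed, and depths
    -- change only at nodes that were not ready, so held nodes keep theirs.
    sound-transport : ∀ {E′ d′ pv pb a ph} → (∀ x → E x ≡ true → E′ x ≡ true) →
                      (∀ v → Ready E v → d′ v ≡ d v) → Sound E d pv pb a ph → Sound E′ d′ pv pb a ph
    sound-transport {E′} {d′} {pv} {pb} {ph = ph} grow agree S = record
      { ready-assigned   = Maybe.map still-ready (ready-assigned S)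
      ; ready-held       = All.map still-ready (ready-held S)
      ; decreasing       = decreasing-agree same (decreasing S)
      ; assigned-deepest = Maybe.zipWith deepest (ready-assigned S , assigned-deepest S)
      ; bottom-public    = bottom-public S
      ; idle             = idle S }
      where
        still-ready : ∀ {v} → Ready E v → Ready E′ v
        still-ready r x anc = grow x (r x anc)
        same : All (λ v → d′ v ≡ d v) (held ph pv pb)
        same = All.map (agree _) (ready-held S)
        deepest : ∀ {u} → Ready E u × HeadAtMost d (d u) (held ph pv pb) →
                  HeadAtMost d′ (d′ u) (held ph pv pb)
        deepest (ru , h) = subst (λ k → HeadAtMost d′ k _) (sym (agree _ ru)) (headAtMost-agree same h)

    initially-sound : ∀ {a} → Maybe.All (Ready E) a → Sound E d [] [] a start
    initially-sound ra = record
      { ready-assigned   = ra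
      ; ready-held       = []
      ; decreasing       = []
      ; assigned-deepest = Maybe.map (λ _ → tt) ra
      ; bottom-public    = λ ()
      ; idle             = λ _ _ → refl }

    deque-ordered : ∀ {pv pb a ph} → Sound E d pv pb a ph →
                    Decreasing d (pv ++ pb) × Maybe.All (λ u → HeadAtMost d (d u) (pv ++ pb)) a
    deque-ordered {ph = ph} S =
        linked-suffix (pending ph) (decreasing S)
      , Maybe.map (headAtMost-suffix (pending ph) (decreasing S)) (assigned-deepest S)

module Execution (G : Graph) (P : ℕ) where
  open LCWS G P

  private
    N : Set
    N = Node G

  setDepths-outside : ∀ L k (d : N → ℕ) v → ¬ v ∈ L → setDepths L k d v ≡ d v
  setDepths-outside []      k d v _    = refl
  setDepths-outside (x ∷ L) k d v v∉ with v ≟ x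
  ... | yes v≡x = ⊥-elim (v∉ (here v≡x))
  ... | no _    = setDepths-outside L k d v (λ v∈ → v∉ (there v∈))

  setDepths-inside : ∀ L k (d : N → ℕ) v → v ∈ L → setDepths L k d v ≡ k
  setDepths-inside (x ∷ L) k d v v∈ with v ≟ x | v∈
  ... | yes _   | _        = refl
  ... | no v≢x  | here v≡x = ⊥-elim (v≢x v≡x)
  ... | no _    | there v∈L = setDepths-inside L k d v v∈L

  markExec-grows : ∀ (E : N → Bool) u x → E x ≡ true → markExec E u x ≡ true
  markExec-grows E u x Ex with x ≟ u
  ... | yes _ = refl
  ... | no _  = Ex

  module _ (s : State) (u : N) (L : List N) (enabled : EnabledList s u L) where

    private
      s′ : State
      s′ = execState s u L

    depth-kept : ∀ v → Ready (executed s) v → depth s′ v ≡ depth s v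
    depth-kept v rv = setDepths-outside L _ _ v (λ v∈L → proj₁ (proj₁ (proj₂ enabled v) v∈L) rv)

    child-ready : ∀ v → v ∈ L → Ready (executed s′) v
    child-ready v v∈L = proj₂ (proj₁ (proj₂ enabled v) v∈L)

    child-depth : ∀ v → v ∈ L → Ready (executed s) u → depth s′ v ≡ suc (depth s′ u)
    child-depth v v∈L ru = trans (setDepths-inside L _ _ v v∈L) (cong suc (sym (depth-kept u ru)))

weight-antitone : ∀ T {m n} → m ≤ n → + T ℤ.- + n ℤ.≤ + T ℤ.- + m
weight-antitone T m≤n = ℤ.+-monoʳ-≤ (+ T) (ℤ.neg-mono-≤ (ℤ.+≤+ m≤n))

weight-antitone-strict : ∀ T {m n} → m < n → + T ℤ.- + n ℤ.< + T ℤ.- + m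
weight-antitone-strict T m<n = ℤ.+-monoʳ-< (+ T) (ℤ.neg-mono-< (ℤ.+<+ m<n))

module States (G : Graph) (P : ℕ) where
  open LCWS G P
  open Invariant G P
  open Execution G P

  SoundProc : State → Proc → Set
  SoundProc s q = Sound (executed s) (depth s) (priv q) (pub q) (assigned q) (phase q)

  record Inv (s : State) : Set where
    constructor all-sound
    field sound : ∀ k → SoundProc s (procs s k)

  open Inv

  -- Changing one processor keeps the invariant if that processor stays sound.
  -- (The change g must be given: it cannot be inferred from the new state.)
  update : ∀ {s i} g → Inv s → SoundProc s (g (procs s i)) → Inv (modify s i g)
  update {s} {i} g I J = all-sound (upd-all (procs s) i g (SoundProc s) (sound I) J)

  sound-assigned : ∀ {E d pv pb a a′ ph} → a ≡ a′ → Sound E d pv pb a ph → Sound E d pv pb a′ ph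
  sound-assigned refl S = S

  toPhase : Phase → Proc → Proc
  toPhase ph q = record q { phase = ph }

  executed-inv : ∀ s u L → EnabledList s u L → Inv s → Inv (execState s u L)
  executed-inv s u L enabled I = all-sound λ k →
    sound-transport (markExec-grows (executed s) u) (depth-kept s u L enabled) (sound I k)

  step-inv : ∀ {i s s′} → Inv s → Step i s s′ → Inv s′
  step-inv {i} {s} I (tgt-move {init} {x} ph _ pr) =
    update (λ q → record q { priv = init ; pub = x ∷ pub q ; phase = clearTarget }) I
      (reshape (settledAt ph st-start) st-clear
        (trans (cong₂ (λ p v → held p v (pub (procs s i))) ph pr) (++-assoc init [ x ] _)) (sound I i))
  step-inv {i} I (tgt-empty ph _ _) =
    update (toPhase clearTarget) I (rephase ph st-start st-clear refl (sound I i))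
  step-inv {i} I (clear ph) =
    update (λ q → record q { targeted = false ; phase = main }) I
      (rephase ph st-clear st-main refl (sound I i))
  step-inv {i} I (no-tgt ph _) =
    update (toPhase main) I (rephase ph st-start st-main refl (sound I i))
  step-inv {i} {s} I (exec0 {u} ph as enabled) =
    update (λ q → record q { assigned = nothing ; phase = popPhase }) I′ (exec-leaf ph (sound I′ i))
    where
      I′ : Inv (execState s u [])
      I′ = executed-inv s u [] enabled I
  step-inv {i} {s} I (exec1 {u} {c} ph as enabled) =
    update (λ q → record q { assigned = just c ; phase = start }) I′
      (exec-one ph (child-ready s u _ enabled c (here refl))
                   (child-depth s u _ enabled c (here refl) ru)
                   (sound-assigned as (sound I′ i)))
    where
      I′ : Inv (execState s u [ c ])
      I′ = executed-inv s u [ c ] enabled I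
      ru : Ready (executed s) u
      ru = Maybe.drop-just (Sound.ready-assigned (sound-assigned as (sound I i)))
  step-inv {i} {s} I (exec2 {u} {c} {c′} ph as enabled) =
    update (λ q → record q { assigned = just c ; phase = pushPending c′ }) I′
      (exec-two ph (child-ready s u _ enabled c (here refl))
                   (child-depth s u _ enabled c (here refl) ru)
                   (child-ready s u _ enabled c′ (there (here refl)))
                   (child-depth s u _ enabled c′ (there (here refl)) ru)
                   (sound-assigned as (sound I′ i)))
    where
      I′ : Inv (execState s u (c ∷ c′ ∷ []))
      I′ = executed-inv s u (c ∷ c′ ∷ []) enabled I
      ru : Ready (executed s) u
      ru = Maybe.drop-just (Sound.ready-assigned (sound-assigned as (sound I i)))
  step-inv {i} {s} I (push {b} ph) =
    update (λ q → record q { priv = b ∷ priv q ; phase = start }) I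
      (reshape (settledAt ph (st-push b)) st-start (cong (λ p → held p (priv (procs s i)) (pub (procs s i))) ph) (sound I i))
  step-inv {i} {s} I (pop-ok {x} {rest} ph pr) =
    update (λ q → record q { priv = rest ; assigned = just x ; phase = start }) I
      (adopt (cong₂ (λ p v → held p v (pub (procs s i))) ph pr) (sound I i))
  step-inv {i} I (pop-race ph pr) =
    update (toPhase popBottomPhase) I (race-to-popBottom ph pr (sound I i))
  step-inv {i} I (popB-ok {x} {rest} ph pr) =
    update (λ q → record q { pub = rest ; assigned = just x ; phase = start }) I
      (popBottom-ok ph pr (sound I i))
  step-inv {i} I (popB-empty ph pr) =
    update (λ q → record q { assigned = nothing ; phase = start }) I
      (popBottom-empty ph pr (sound I i))
  step-inv {i} {s} I (steal-ok {init} {x} j ph as pr) with j ≟ i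
  ... | yes refl =
    ⊥-elim (snoc-nonempty init x (trans (sym pr) (++-conicalʳ _ _ (idle-empty ph as (sound I i)))))
  ... | no j≢i =
    update (λ q → record q { assigned = just x ; phase = start }) I′
      (subst (λ q → Sound _ _ (priv q) (pub q) (just x) start) (sym thief-unchanged)
        (steal-thief ph as rx (sound I i)))
    where
      cut : Proc → Proc
      cut q = record q { pub = init }
      victim : Sound (executed s) (depth s) (priv (procs s j)) init (assigned (procs s j)) (phase (procs s j))
             × Ready (executed s) x
      victim = steal-victim pr (sound I j)
      rx : Ready (executed s) x
      rx = proj₂ victim
      I′ : Inv (modify s j cut)
      I′ = update cut I (proj₁ victim)
      thief-unchanged : procs (modify s j cut) i ≡ procs s i
      thief-unchanged = upd-other (procs s) j cut i (λ i≡j → j≢i (sym i≡j))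
  step-inv {i} I (steal-empty j ph _ _) =
    update (toPhase (setTarget j)) I (rephase ph st-main (st-target j) refl (sound I i))
  step-inv {i} I (steal-abort j ph _) =
    update (toPhase start) I (rephase ph st-main st-start refl (sound I i))
  step-inv {i} {s} I (set-tgt {j} ph) =
    update (toPhase start) I′ (rephase (trans same-phase ph) (st-target j) st-start refl (sound I′ i))
    where
      flag : Proc → Proc
      flag q = record q { targeted = true }
      I′ : Inv (modify s j flag)
      I′ = update flag I (sound I j)
      same-phase : phase (procs (modify s j flag) i) ≡ phase (procs s i)
      same-phase = upd-attribute (procs s) j flag phase (λ _ → refl) i

  reachable-inv : ∀ {s s′} → Inv s → Star AnyStep s s′ → Inv s′
  reachable-inv I ε                  = I
  reachable-inv I ((_ , st) ◅ steps) = reachable-inv (step-inv I st) steps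

  -- Initially only the root is assigned, and it is ready: it has no ancestors.
  initial-inv : (C : IsComputation G) (p0 : Fin P) → Inv (initial (root C) p0)
  initial-inv C p0 = all-sound λ k → initially-sound (root-assignment k)
    where
      root-ready : Ready (λ _ → false) (root C)
      root-ready _ (_ , path) with last-edge path
      ... | (u , edge) = ⊥-elim (root-noIn C u edge)

      root-assignment : ∀ k → Maybe.All (Ready (λ _ → false)) (if ⌊ k ≟ p0 ⌋ then just (root C) else nothing)
      root-assignment k with k ≟ p0
      ... | yes _ = Maybe.just root-ready
      ... | no _  = Maybe.nothing

  weight-ordered : ∀ T s p → SoundProc s (procs s p) → WeightOrdered T s p
  weight-ordered T s p S = assigned-first , Linked.map (weight-antitone-strict T) decreasing
    where
      deque : List (Node G)
      deque = priv (procs s p) ++ pub (procs s p)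
      ordered : Decreasing (depth s) deque ×
                Maybe.All (λ u → HeadAtMost (depth s) (depth s u) deque) (assigned (procs s p))
      ordered = deque-ordered S
      decreasing : Decreasing (depth s) deque
      decreasing = proj₁ ordered
      assigned-first : ∀ v₀ v₁ rest → assigned (procs s p) ≡ just v₀ → deque ≡ v₁ ∷ rest →
                       weight T s v₀ ℤ.≤ weight T s v₁
      assigned-first v₀ v₁ rest a≡v₀ deque≡ =
        weight-antitone T (headAtMost-head deque≡ (Maybe.drop-just (subst (Maybe.All _) a≡v₀ (proj₂ ordered))))

-- The ordering of w = T − d holds for every T.
corollary1 : (G : Graph) (C : IsComputation G) (T : ℕ) → IsSpan G T →
             (P : ℕ) (p0 : Fin P) (s : LCWS.State G P) →
             LCWS.Reachable G P (root C) p0 s →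
             (p : Fin P) → LCWS.WeightOrdered G P T s p
corollary1 G C T _ P p0 s reachable p =
  weight-ordered T s p (sound (reachable-inv (initial-inv C p0) reachable) p)
  where open States G P
        open Inv
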